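{- If a strongly regular graph $G$ with parameters $(1911,270,105,27)$ exists, then every clique in $G$ has order at most $32$.
   Context: A strongly regular graph with parameters $(n,k,\lambda,\mu)$ is a finite simple $k$-regular graph on $n$ vertices in which any two distinct adjacent vertices have exactly $\lambda$ common neighbours and any two distinct non-adjacent vertices have exactly $\mu$ common neighbours. -}

module Defs where

open import Data.Nat using (ℕ)
open import Data.Bool using (Bool; true; false; _∧_)
open import Data.Fin using (Fin)
open import Data.Fin.Subset using (Subset; _∈_)
open import Data.List using (length; filterᵇ)
open import Data.List using (List)
open import Data.Product using (_×_)
open import Relation.Binary.PropositionalEquality using (_≡_; _≢_)
import Data.List as L

record Graph (n : ℕ) : Set where
  field
    adj     : Fin n → Fin n → Bool
    symm    : ∀ x y → adj x y ≡ adj y x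
    irrefl  : ∀ x → adj x x ≡ false

open Graph public

vertices : (n : ℕ) → List (Fin n)
vertices n = L.allFin n

degree : ∀ {n} → Graph n → Fin n → ℕ
degree {n} G x = length (filterᵇ (adj G x) (vertices n))

commonNbrs : ∀ {n} → Graph n → Fin n → Fin n → ℕ
commonNbrs {n} G x y = length (filterᵇ (λ z → adj G x z ∧ adj G y z) (vertices n))

IsSRG : ∀ {n} → Graph n → (k lam mu : ℕ) → Set
IsSRG {n} G k lam mu =
  (∀ x → degree G x ≡ k)
  × (∀ x y → x ≢ y → adj G x y ≡ true  → commonNbrs G x y ≡ lam)
  × (∀ x y → x ≢ y → adj G x y ≡ false → commonNbrs G x y ≡ mu)

IsClique : ∀ {n} → Graph n → Subset n → Set
IsClique G S = ∀ x y → x ∈ S → y ∈ S → x ≢ y → adj G x y ≡ true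

module Submission where

-- The adjacency matrix A has eigenvalues 270, 81 and −3, so K = 7A + 21I − J, a positive
-- multiple of the projection onto the 81-eigenspace, has a nonnegative quadratic form.
-- Every clique lies in a maximal one, so let T be a maximal clique of size c ≥ 33. A vertex v
-- outside T has a non-neighbour in T, hence a = |N(v) ∩ T| ≤ μ = 27; evaluating the form of K on a
-- vector supported on T ∪ {v} gives b(3a − 17) ≤ 4(3a + 10) with b = c − a ≥ 6, which forces a ≤ 7.
-- Summing over all vertices, ∑ a_v = 270c and ∑ a_v² = c(270 + 105(c − 1)), while a_v = c − 1 on T
-- and 0 ≤ a_v ≤ 7 off T; the resulting three polynomial inequalities in c have no solution c ≥ 33.

open import Data.Fin.Subset using (Subset; ∣_∣)
open import Defs

-- The development is scoped so that the _≤_ of the final statement is the order on ℕ.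
module _ where

  open import Agda.Builtin.FromNat using (Number; fromNat)
  open import Data.Bool.Base using (Bool; true; false; _∧_)
  open import Data.Bool.Properties as Bool using (¬-not)
  open import Data.Empty using (⊥; ⊥-elim)
  open import Data.Fin.Base using (Fin; zero; suc)
  open import Data.Fin.Properties using (_≟_; any?; all?; ¬∀⟶∃¬)
  open import Data.Fin.Subset using (_∈_; _∉_; _⊆_; _⊃_; _∪_; ⁅_⁆)
  open import Data.Fin.Subset.Induction using (⊃-wellFounded; Acc; acc)
  open import Data.Fin.Subset.Properties using (_∈?_; ⊆-refl; ⊆-trans; p⊆p∪q; x∈p∪q⁻; x∈p∪q⁺; x∈⁅x⁆; x∈⁅y⁆⇒x≡y)
  open import Data.Integer.Base using (ℤ; _+_; _-_; -_; _*_; _≤_; _<_; +≤+)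
  import Data.Integer.Base as ℤ using (+_; -[1+_])
  import Data.Integer.Literals as ℤ
  import Data.Integer.Properties as ℤ
  open import Data.Integer.Tactic.RingSolver using (solve-∀; solve)
  open import Data.List.Base using ([]; _∷_; length; filterᵇ; tabulate)
  open import Data.Nat.Base using (ℕ; zero; suc; z≤n)
  import Data.Nat.Base as ℕ using (_≤_; _<_)
  import Data.Nat.Literals as ℕ
  import Data.Nat.Properties as ℕ
  open import Data.Product using (_×_; _,_; proj₁; proj₂; ∃-syntax)
  open import Data.Sum using (_⊎_; inj₁; inj₂; [_,_]′)
  open import Data.Unit.Base using (tt)
  open import Data.Vec.Base using (lookup)
  import Data.Vec.Base as Vec
  open import Data.Vec.Functional using (Vector)
  open import Data.Vec.Properties using (lookup⇒[]=; []=⇒lookup)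
  open import Function.Base using (id; _∘_)
  open import Relation.Binary.PropositionalEquality
  open import Relation.Nullary using (¬_; does; yes; no; ¬?; _×-dec_; _→-dec_)
  open import Relation.Nullary.Decidable using (dec-true)

  instance
    ℕ-number : Number ℕ
    ℕ-number = ℕ.number
    ℤ-number : Number ℤ
    ℤ-number = ℤ.number

  open import Algebra.Properties.Semiring.Sum ℤ.+-*-semiring
    using (sum; sum-syntax; sum-cong-≗; sum-replicate-zero; ∑-distrib-+; ∑-comm; *-distribˡ-sum; *-distribʳ-sum)

  private
    variable
      n : ℕ

  ∑-neg : (f : Vector ℤ n) → ∑[ i < n ] (- f i) ≡ - sum f
  ∑-neg {zero}  f = refl
  ∑-neg {suc n} f = begin
    - f zero + ∑[ i < n ] (- f (suc i))  ≡⟨ cong (- f zero +_) (∑-neg (f ∘ suc)) ⟩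
    - f zero + - sum (f ∘ suc)            ≡⟨ ℤ.neg-distrib-+ (f zero) _ ⟨
    - sum f                               ∎
    where open ≡-Reasoning

  ∑-distrib-- : (f g : Vector ℤ n) → ∑[ i < n ] (f i - g i) ≡ sum f - sum g
  ∑-distrib-- f g = trans (∑-distrib-+ f (-_ ∘ g)) (cong (sum f +_) (∑-neg g))

  ∑-const : ∀ n (x : ℤ) → ∑[ i < n ] x ≡ ℤ.+ n * x
  ∑-const zero    x = sym (ℤ.*-zeroˡ x)
  ∑-const (suc n) x = begin
    x + ∑[ i < n ] x   ≡⟨ cong₂ _+_ (sym (ℤ.*-identityˡ x)) (∑-const n x) ⟩
    1 * x + ℤ.+ n * x  ≡⟨ ℤ.*-distribʳ-+ x 1 (ℤ.+ n) ⟨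
    (1 + ℤ.+ n) * x    ∎
    where open ≡-Reasoning

  ∑-mono-≤ : {f g : Vector ℤ n} → (∀ i → f i ≤ g i) → sum f ≤ sum g
  ∑-mono-≤ {zero}  f≤g = ℤ.≤-refl
  ∑-mono-≤ {suc n} f≤g = ℤ.+-mono-≤ (f≤g zero) (∑-mono-≤ (f≤g ∘ suc))

  ∑-nonneg : {f : Vector ℤ n} → (∀ i → 0 ≤ f i) → 0 ≤ sum f
  ∑-nonneg {n} 0≤f = ℤ.≤-trans (ℤ.≤-reflexive (sym (sum-replicate-zero n))) (∑-mono-≤ 0≤f)

  ⟦_⟧ : Bool → ℤ
  ⟦ true  ⟧ = 1
  ⟦ false ⟧ = 0

  ⟦∧⟧ : ∀ a b → ⟦ a ∧ b ⟧ ≡ ⟦ a ⟧ * ⟦ b ⟧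
  ⟦∧⟧ true  b = sym (ℤ.*-identityˡ ⟦ b ⟧)
  ⟦∧⟧ false b = refl

  ⟦⟧-idem : ∀ b → ⟦ b ⟧ * ⟦ b ⟧ ≡ ⟦ b ⟧
  ⟦⟧-idem true  = refl
  ⟦⟧-idem false = refl

  ⟦⟧-nonneg : ∀ b → 0 ≤ ⟦ b ⟧
  ⟦⟧-nonneg true  = +≤+ z≤n
  ⟦⟧-nonneg false = +≤+ z≤n

  ∑-length-filterᵇ : ∀ {A : Set} (p : A → Bool) (f : Fin n → A) →
    ℤ.+ length (filterᵇ p (tabulate f)) ≡ ∑[ i < n ] ⟦ p (f i) ⟧
  ∑-length-filterᵇ {zero}  p f = refl
  ∑-length-filterᵇ {suc n} p f with p (f zero)
  ... | true  = cong (1 +_) (∑-length-filterᵇ p (f ∘ suc))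
  ... | false = trans (∑-length-filterᵇ p (f ∘ suc)) (sym (ℤ.+-identityˡ _))

  χ : Subset n → Vector ℤ n
  χ T i = ⟦ lookup T i ⟧

  ∣_∣ᶻ : Subset n → ℤ
  ∣ T ∣ᶻ = sum (χ T)

  ∣∣≡∣∣ᶻ : (T : Subset n) → ℤ.+ ∣ T ∣ ≡ ∣ T ∣ᶻ
  ∣∣≡∣∣ᶻ Vec.[]          = refl
  ∣∣≡∣∣ᶻ (true  Vec.∷ T) = cong (1 +_) (∣∣≡∣∣ᶻ T)
  ∣∣≡∣∣ᶻ (false Vec.∷ T) = trans (∣∣≡∣∣ᶻ T) (sym (ℤ.+-identityˡ _))

  χ-∈ : {T : Subset n} {w : Fin n} → w ∈ T → χ T w ≡ 1
  χ-∈ w∈T = cong ⟦_⟧ ([]=⇒lookup w∈T)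

  χ-∉ : {T : Subset n} {w : Fin n} → w ∉ T → χ T w ≡ 0
  χ-∉ {T = T} {w} w∉T = cong ⟦_⟧ (¬-not (w∉T ∘ lookup⇒[]= w T))

  SupportedOn : Subset n → Vector ℤ n → Set
  SupportedOn T y = ∀ w → w ∉ T → y w ≡ 0

  δ : Fin n → Fin n → ℤ
  δ i j = ⟦ does (i ≟ j) ⟧

  δ-refl : (i : Fin n) → δ i i ≡ 1
  δ-refl i = cong ⟦_⟧ (dec-true (i ≟ i) refl)

  δ-sym : (i j : Fin n) → δ i j ≡ δ j i
  δ-sym i j with i ≟ j | j ≟ i
  ... | yes _   | yes _   = refl
  ... | no _    | no _    = refl
  ... | yes i≡j | no j≢i  = ⊥-elim (j≢i (sym i≡j))
  ... | no i≢j  | yes j≡i = ⊥-elim (i≢j (sym j≡i))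

  ∑-δ : (i : Fin n) (f : Vector ℤ n) → ∑[ j < n ] (δ i j * f j) ≡ f i
  ∑-δ {suc n} zero f = begin
    1 * f zero + ∑[ j < n ] (0 * f (suc j))  ≡⟨ cong₂ _+_ (ℤ.*-identityˡ (f zero)) (sum-cong-≗ (ℤ.*-zeroˡ ∘ f ∘ suc)) ⟩
    f zero + ∑[ j < n ] 0                    ≡⟨ cong (f zero +_) (sum-replicate-zero n) ⟩
    f zero + 0                               ≡⟨ ℤ.+-identityʳ (f zero) ⟩
    f zero                                   ∎
    where open ≡-Reasoning
  ∑-δ {suc n} (suc i) f = trans (ℤ.+-identityˡ _) (∑-δ i (f ∘ suc))

  ∑-linear₃ : (a b c : ℤ) (f g h : Vector ℤ n) →
    ∑[ i < n ] (a * f i + b * g i + c * h i) ≡ a * sum f + b * sum g + c * sum h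
  ∑-linear₃ {n} a b c f g h = begin
    ∑[ i < n ] (a * f i + b * g i + c * h i)
      ≡⟨ ∑-distrib-+ (λ i → a * f i + b * g i) (λ i → c * h i) ⟩
    ∑[ i < n ] (a * f i + b * g i) + ∑[ i < n ] (c * h i)
      ≡⟨ cong (_+ ∑[ i < n ] (c * h i)) (∑-distrib-+ (λ i → a * f i) (λ i → b * g i)) ⟩
    ∑[ i < n ] (a * f i) + ∑[ i < n ] (b * g i) + ∑[ i < n ] (c * h i)
      ≡⟨ cong₂ _+_ (cong₂ _+_ (*-distribˡ-sum a f) (*-distribˡ-sum b g)) (*-distribˡ-sum c h) ⟨
    a * sum f + b * sum g + c * sum h ∎
    where open ≡-Reasoning

  *-nonneg : {i j : ℤ} → 0 ≤ i → 0 ≤ j → 0 ≤ i * j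
  *-nonneg {ℤ.+ m} {ℤ.+ n} _ _ = subst (0 ≤_) (ℤ.pos-* m n) (+≤+ z≤n)

  square-nonneg : (i : ℤ) → 0 ≤ i * i
  square-nonneg (ℤ.+ m)    = *-nonneg {ℤ.+ m} {ℤ.+ m} (+≤+ z≤n) (+≤+ z≤n)
  square-nonneg ℤ.-[1+ m ] = +≤+ z≤n

  nonneg≢negative : {x : ℤ} {m : ℕ} → 0 ≤ x → x ≢ ℤ.-[1+ m ]
  nonneg≢negative () refl

  *-cancelˡ-nonneg : {k r : ℤ} → 0 < k → 0 ≤ k * r → 0 ≤ r
  *-cancelˡ-nonneg {k} {r} 0<k 0≤kr =
    ℤ.*-cancelˡ-≤-pos 0 r k ⦃ ℤ.positive 0<k ⦄ (subst (_≤ k * r) (sym (ℤ.*-zeroʳ k)) 0≤kr)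

  ≤⊎1+≤ : ∀ k i → i ≤ k ⊎ 1 + k ≤ i
  ≤⊎1+≤ k i with i ℤ.≤? k
  ... | yes i≤k = inj₁ i≤k
  ... | no  i≰k = inj₂ (ℤ.i<j⇒suc[i]≤j (ℤ.≰⇒> i≰k))

  Matrix : ℕ → Set
  Matrix n = Fin n → Fin n → ℤ

  IsSymmetric : Matrix n → Set
  IsSymmetric M = ∀ i j → M i j ≡ M j i

  infixr 7 _⊛_
  infixl 7 _·_

  _⊛_ : Matrix n → Vector ℤ n → Vector ℤ n
  (M ⊛ x) i = ∑[ j < _ ] (M i j * x j)

  _·_ : Matrix n → Matrix n → Matrix n
  (M · N) i j = ∑[ k < _ ] (M i k * N k j)

  ⟪_,_⟫ : Vector ℤ n → Vector ℤ n → ℤ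
  ⟪ x , y ⟫ = ∑[ i < _ ] (x i * y i)

  quadForm : Matrix n → Vector ℤ n → ℤ
  quadForm M x = ⟪ x , M ⊛ x ⟫

  ⟪⟫-self-nonneg : (x : Vector ℤ n) → 0 ≤ ⟪ x , x ⟫
  ⟪⟫-self-nonneg x = ∑-nonneg (λ i → square-nonneg (x i))

  ⊛-self-adjoint : {M : Matrix n} → IsSymmetric M → (x y : Vector ℤ n) → ⟪ x , M ⊛ y ⟫ ≡ ⟪ M ⊛ x , y ⟫
  ⊛-self-adjoint {n} {M} M-sym x y = begin
    ∑[ i < n ] (x i * ∑[ j < n ] (M i j * y j))  ≡⟨ sum-cong-≗ (λ i → *-distribˡ-sum (x i) (λ j → M i j * y j)) ⟩
    ∑[ i < n ] ∑[ j < n ] (x i * (M i j * y j))  ≡⟨ ∑-comm (λ i j → x i * (M i j * y j)) ⟩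
    ∑[ j < n ] ∑[ i < n ] (x i * (M i j * y j))  ≡⟨ sum-cong-≗ (λ j → sum-cong-≗ (λ i → reorder i j)) ⟩
    ∑[ j < n ] ∑[ i < n ] (M j i * x i * y j)    ≡⟨ sum-cong-≗ (λ j → *-distribʳ-sum (y j) (λ i → M j i * x i)) ⟨
    ∑[ j < n ] (∑[ i < n ] (M j i * x i) * y j)  ∎
    where
    open ≡-Reasoning
    reorder : ∀ i j → x i * (M i j * y j) ≡ M j i * x i * y j
    reorder i j rewrite M-sym i j =
      trans (sym (ℤ.*-assoc (x i) (M j i) (y j))) (cong (_* y j) (ℤ.*-comm (x i) (M j i)))

  ⊛-assoc : (M N : Matrix n) (z : Vector ℤ n) → ∀ i → ((M · N) ⊛ z) i ≡ (M ⊛ N ⊛ z) i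
  ⊛-assoc {n} M N z i = begin
    ∑[ j < n ] (∑[ k < n ] (M i k * N k j) * z j)  ≡⟨ sum-cong-≗ (λ j → *-distribʳ-sum (z j) (λ k → M i k * N k j)) ⟩
    ∑[ j < n ] ∑[ k < n ] (M i k * N k j * z j)    ≡⟨ ∑-comm (λ j k → M i k * N k j * z j) ⟩
    ∑[ k < n ] ∑[ j < n ] (M i k * N k j * z j)    ≡⟨ sum-cong-≗ (λ k → sum-cong-≗ (λ j → ℤ.*-assoc (M i k) (N k j) (z j))) ⟩
    ∑[ k < n ] ∑[ j < n ] (M i k * (N k j * z j))  ≡⟨ sum-cong-≗ (λ k → *-distribˡ-sum (M i k) (λ j → N k j * z j)) ⟨
    ∑[ k < n ] (M i k * ∑[ j < n ] (N k j * z j))  ∎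
    where open ≡-Reasoning

  ⊛-affine : {N : Matrix n} (M : Matrix n) (a b c : ℤ) → (∀ i j → N i j ≡ a * M i j + b * δ i j + c) →
    (f : Vector ℤ n) → ∀ i → (N ⊛ f) i ≡ a * (M ⊛ f) i + b * f i + c * sum f
  ⊛-affine {n} {N} M a b c N≡ f i = begin
    ∑[ j < n ] (N i j * f j)
      ≡⟨ sum-cong-≗ (λ j → trans (cong (_* f j) (N≡ i j)) (distrib a (M i j) b (δ i j) c (f j))) ⟩
    ∑[ j < n ] (a * (M i j * f j) + b * (δ i j * f j) + c * f j)  ≡⟨ ∑-linear₃ a b c (λ j → M i j * f j) (λ j → δ i j * f j) f ⟩
    a * (M ⊛ f) i + b * ∑[ j < n ] (δ i j * f j) + c * sum f    ≡⟨ cong (λ s → a * (M ⊛ f) i + b * s + c * sum f) (∑-δ i f) ⟩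
    a * (M ⊛ f) i + b * f i + c * sum f                         ∎
    where
    open ≡-Reasoning
    distrib : ∀ a m b d c f → (a * m + b * d + c) * f ≡ a * (m * f) + b * (d * f) + c * f
    distrib = solve-∀

  quadForm-nonneg : {M : Matrix n} {k : ℤ} → IsSymmetric M → 0 < k →
    (∀ i j → (M · M) i j ≡ k * M i j) → ∀ z → 0 ≤ quadForm M z
  quadForm-nonneg {n} {M} {k} M-sym 0<k M²≡kM z = *-cancelˡ-nonneg 0<k (subst (0 ≤_) ‖Mz‖²≡k·Q (⟪⟫-self-nonneg (M ⊛ z)))
    where
    open ≡-Reasoning
    M⊛M⊛z : ∀ i → (M ⊛ M ⊛ z) i ≡ k * (M ⊛ z) i
    M⊛M⊛z i = begin
      (M ⊛ M ⊛ z) i                  ≡⟨ ⊛-assoc M M z i ⟨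
      ∑[ j < n ] ((M · M) i j * z j)  ≡⟨ sum-cong-≗ (λ j → trans (cong (_* z j) (M²≡kM i j)) (ℤ.*-assoc k (M i j) (z j))) ⟩
      ∑[ j < n ] (k * (M i j * z j))  ≡⟨ *-distribˡ-sum k (λ j → M i j * z j) ⟨
      k * (M ⊛ z) i                  ∎

    ‖Mz‖²≡k·Q : ⟪ M ⊛ z , M ⊛ z ⟫ ≡ k * quadForm M z
    ‖Mz‖²≡k·Q = begin
      ⟪ M ⊛ z , M ⊛ z ⟫                  ≡⟨ ⊛-self-adjoint M-sym z (M ⊛ z) ⟨
      ∑[ i < n ] (z i * (M ⊛ M ⊛ z) i)   ≡⟨ sum-cong-≗ (λ i → cong (z i *_) (M⊛M⊛z i)) ⟩
      ∑[ i < n ] (z i * (k * (M ⊛ z) i))  ≡⟨ sum-cong-≗ (λ i → ℤ.*-comm (z i) _ ) ⟩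
      ∑[ i < n ] (k * (M ⊛ z) i * z i)    ≡⟨ sum-cong-≗ (λ i → ℤ.*-assoc k ((M ⊛ z) i) (z i)) ⟩
      ∑[ i < n ] (k * ((M ⊛ z) i * z i))  ≡⟨ *-distribˡ-sum k (λ i → (M ⊛ z) i * z i) ⟨
      k * ⟪ M ⊛ z , z ⟫                   ≡⟨ cong (k *_) (⊛-self-adjoint M-sym z z) ⟨
      k * quadForm M z                    ∎

  ⊛-+-basis : (M : Matrix n) (y : Vector ℤ n) (t : ℤ) (v : Fin n) → ∀ i →
    (M ⊛ (λ j → y j + t * δ v j)) i ≡ (M ⊛ y) i + t * M i v
  ⊛-+-basis {n} M y t v i = begin
    ∑[ j < n ] (M i j * (y j + t * δ v j))          ≡⟨ sum-cong-≗ (λ j → distrib (M i j) (y j) t (δ v j)) ⟩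
    ∑[ j < n ] (M i j * y j + t * (δ v j * M i j))  ≡⟨ ∑-distrib-+ (λ j → M i j * y j) (λ j → t * (δ v j * M i j)) ⟩
    (M ⊛ y) i + ∑[ j < n ] (t * (δ v j * M i j))    ≡⟨ cong ((M ⊛ y) i +_) (*-distribˡ-sum t (λ j → δ v j * M i j)) ⟨
    (M ⊛ y) i + t * ∑[ j < n ] (δ v j * M i j)      ≡⟨ cong (λ s → (M ⊛ y) i + t * s) (∑-δ v (M i)) ⟩
    (M ⊛ y) i + t * M i v                          ∎
    where
    open ≡-Reasoning
    distrib : ∀ m y t d → m * (y + t * d) ≡ m * y + t * (d * m)
    distrib = solve-∀

  quadForm-+-basis : {M : Matrix n} → IsSymmetric M → (y : Vector ℤ n) (t : ℤ) (v : Fin n) →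
    quadForm M (λ i → y i + t * δ v i) ≡ quadForm M y + 2 * t * (M ⊛ y) v + t * t * M v v
  quadForm-+-basis {n} {M} M-sym y t v = begin
    ∑[ i < n ] ((y i + t * δ v i) * (M ⊛ (λ j → y j + t * δ v j)) i)
      ≡⟨ sum-cong-≗ (λ i → cong ((y i + t * δ v i) *_) (⊛-+-basis M y t v i)) ⟩
    ∑[ i < n ] ((y i + t * δ v i) * ((M ⊛ y) i + t * M i v))
      ≡⟨ sum-cong-≗ (λ i → distrib (y i) t (δ v i) ((M ⊛ y) i) (M i v)) ⟩
    ∑[ i < n ] (y i * (M ⊛ y) i + t * (y i * M i v + δ v i * ((M ⊛ y) i + t * M i v)))
      ≡⟨ ∑-distrib-+ (λ i → y i * (M ⊛ y) i) (λ i → t * (y i * M i v + δ v i * ((M ⊛ y) i + t * M i v))) ⟩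
    quadForm M y + ∑[ i < n ] (t * (y i * M i v + δ v i * ((M ⊛ y) i + t * M i v)))
      ≡⟨ cong (quadForm M y +_) (*-distribˡ-sum t (λ i → y i * M i v + δ v i * ((M ⊛ y) i + t * M i v))) ⟨
    quadForm M y + t * ∑[ i < n ] (y i * M i v + δ v i * ((M ⊛ y) i + t * M i v))
      ≡⟨ cong (λ s → quadForm M y + t * s) (∑-distrib-+ (λ i → y i * M i v) (λ i → δ v i * ((M ⊛ y) i + t * M i v))) ⟩
    quadForm M y + t * (∑[ i < n ] (y i * M i v) + ∑[ i < n ] (δ v i * ((M ⊛ y) i + t * M i v)))
      ≡⟨ cong (λ s → quadForm M y + t * s) (cong₂ _+_ column≡row (∑-δ v (λ i → (M ⊛ y) i + t * M i v))) ⟩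
    quadForm M y + t * ((M ⊛ y) v + ((M ⊛ y) v + t * M v v))
      ≡⟨ collect (quadForm M y) t ((M ⊛ y) v) (M v v) ⟩
    quadForm M y + 2 * t * (M ⊛ y) v + t * t * M v v ∎
    where
    open ≡-Reasoning
    distrib : ∀ y t d m c → (y + t * d) * (m + t * c) ≡ y * m + t * (y * c + d * (m + t * c))
    distrib = solve-∀
    collect : ∀ q t m c → q + t * (m + (m + t * c)) ≡ q + 2 * t * m + t * t * c
    collect = solve-∀
    column≡row : ∑[ i < n ] (y i * M i v) ≡ (M ⊛ y) v
    column≡row = sum-cong-≗ (λ i → trans (ℤ.*-comm (y i) (M i v)) (cong (_* y i) (M-sym i v)))

  -- A, K, splitWeights (and ∣_∣ᶻ above) are top-level rather than defined inside the parameterised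
  -- modules below: at n = 1911, a module-application copy of a name occurring in a sum makes Agda
  -- compare the two sides by unfolding all 1911 terms.
  A : Graph n → Matrix n
  A G i j = ⟦ adj G i j ⟧

  K : Graph n → ℤ → ℤ → Matrix n
  K G α β i j = α * A G i j + β * δ i j - 1

  splitWeights : Graph n → Subset n → Fin n → ℤ → ℤ → Vector ℤ n
  splitWeights G T v p q w = χ T w * (p * A G v w + q * (1 - A G v w))

  module Adjacency {n : ℕ} (G : Graph n) where

    A-sym : IsSymmetric (A G)
    A-sym i j = cong ⟦_⟧ (symm G i j)

    A-diag : ∀ i → A G i i ≡ 0
    A-diag i = cong ⟦_⟧ (irrefl G i)

    A-edge : ∀ {i j} → adj G i j ≡ true → A G i j ≡ 1
    A-edge = cong ⟦_⟧

    module _ {T : Subset n} (T-clique : IsClique G T) {y : Vector ℤ n} (y-supp : SupportedOn T y) where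

      clique-row : ∀ {w} → w ∈ T → (A G ⊛ y) w ≡ sum y - y w
      clique-row {w} w∈T = begin
        ∑[ u < n ] (A G w u * y u)        ≡⟨ sum-cong-≗ entry ⟩
        ∑[ u < n ] (y u - δ w u * y u)    ≡⟨ ∑-distrib-- y (λ u → δ w u * y u) ⟩
        sum y - ∑[ u < n ] (δ w u * y u)  ≡⟨ cong (λ s → sum y - s) (∑-δ w y) ⟩
        sum y - y w                       ∎
        where
        open ≡-Reasoning
        outside : ∀ a d → a * 0 ≡ 0 - d * 0
        outside = solve-∀
        loop : ∀ x → 0 * x ≡ x - 1 * x
        loop = solve-∀
        edge : ∀ x → 1 * x ≡ x - 0 * x
        edge = solve-∀
        entry : ∀ u → A G w u * y u ≡ y u - δ w u * y u
        entry u with u ∈? T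
        ... | no u∉T rewrite y-supp u u∉T = outside (A G w u) (δ w u)
        ... | yes u∈T with w ≟ u
        ...   | yes refl rewrite A-diag w = loop (y w)
        ...   | no w≢u rewrite A-edge (T-clique w u w∈T u∈T w≢u) = edge (y u)

      quadForm-clique : quadForm (A G) y ≡ sum y * sum y - ⟪ y , y ⟫
      quadForm-clique = begin
        ∑[ w < n ] (y w * (A G ⊛ y) w)        ≡⟨ sum-cong-≗ entry ⟩
        ∑[ w < n ] (y w * sum y - y w * y w)  ≡⟨ ∑-distrib-- (λ w → y w * sum y) (λ w → y w * y w) ⟩
        ∑[ w < n ] (y w * sum y) - ⟪ y , y ⟫  ≡⟨ cong (_- ⟪ y , y ⟫) (*-distribʳ-sum (sum y) y) ⟨
        sum y * sum y - ⟪ y , y ⟫             ∎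
        where
        open ≡-Reasoning
        distrib : ∀ x s → x * (s - x) ≡ x * s - x * x
        distrib = solve-∀
        outside : ∀ r s → 0 * r ≡ 0 * s - 0 * 0
        outside = solve-∀
        entry : ∀ w → y w * (A G ⊛ y) w ≡ y w * sum y - y w * y w
        entry w with w ∈? T
        ... | yes w∈T = trans (cong (y w *_) (clique-row w∈T)) (distrib (y w) (sum y))
        ... | no w∉T rewrite y-supp w w∉T = outside ((A G ⊛ y) w) (sum y)

    A⊛χ-nonneg : ∀ T v → 0 ≤ (A G ⊛ χ T) v
    A⊛χ-nonneg T v = ∑-nonneg (λ w → *-nonneg (⟦⟧-nonneg (adj G v w)) (⟦⟧-nonneg (lookup T w)))

    A⊛χ-member : ∀ {T v} → IsClique G T → v ∈ T → (A G ⊛ χ T) v ≡ ∣ T ∣ᶻ - 1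
    A⊛χ-member {T} T-clique v∈T = trans (clique-row T-clique (λ _ → χ-∉) v∈T) (cong (λ x → ∣ T ∣ᶻ - x) (χ-∈ v∈T))

    module _ (T : Subset n) (v : Fin n) where

      private
        a : ℤ
        a = (A G ⊛ χ T) v

      ∑-split : (p q : ℤ) →
        ∑[ w < n ] (p * (A G v w * χ T w) + q * (χ T w - A G v w * χ T w)) ≡ p * a + q * (∣ T ∣ᶻ - a)
      ∑-split p q = begin
        ∑[ w < n ] (p * (A G v w * χ T w) + q * (χ T w - A G v w * χ T w))
          ≡⟨ ∑-distrib-+ (λ w → p * (A G v w * χ T w)) (λ w → q * (χ T w - A G v w * χ T w)) ⟩
        ∑[ w < n ] (p * (A G v w * χ T w)) + ∑[ w < n ] (q * (χ T w - A G v w * χ T w))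
          ≡⟨ cong₂ _+_ (*-distribˡ-sum p (λ w → A G v w * χ T w)) (*-distribˡ-sum q (λ w → χ T w - A G v w * χ T w)) ⟨
        p * a + q * ∑[ w < n ] (χ T w - A G v w * χ T w)
          ≡⟨ cong (λ s → p * a + q * s) (∑-distrib-- (χ T) (λ w → A G v w * χ T w)) ⟩
        p * a + q * (∣ T ∣ᶻ - a) ∎
        where open ≡-Reasoning

      module _ (p q : ℤ) where

        splitWeights-supported : SupportedOn T (splitWeights G T v p q)
        splitWeights-supported w w∉T rewrite χ-∉ w∉T = ℤ.*-zeroˡ (p * A G v w + q * (1 - A G v w))

        ∑-splitWeights : sum (splitWeights G T v p q) ≡ p * a + q * (∣ T ∣ᶻ - a)
        ∑-splitWeights = trans (sum-cong-≗ (λ w → expand (χ T w) (A G v w))) (∑-split p q)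
          where
          expand : ∀ s e → s * (p * e + q * (1 - e)) ≡ p * (e * s) + q * (s - e * s)
          expand s e = solve (s ∷ e ∷ p ∷ q ∷ [])

        ⟪⟫-splitWeights : ⟪ splitWeights G T v p q , splitWeights G T v p q ⟫ ≡ p * p * a + q * q * (∣ T ∣ᶻ - a)
        ⟪⟫-splitWeights = trans (sum-cong-≗ (λ w → square (lookup T w) (adj G v w))) (∑-split (p * p) (q * q))
          where
          square : ∀ s e → let y = ⟦ s ⟧ * (p * ⟦ e ⟧ + q * (1 - ⟦ e ⟧)) in
            y * y ≡ p * p * (⟦ e ⟧ * ⟦ s ⟧) + q * q * (⟦ s ⟧ - ⟦ e ⟧ * ⟦ s ⟧)
          square true  true  = solve (p ∷ q ∷ [])
          square true  false = solve (p ∷ q ∷ [])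
          square false true  = solve (p ∷ q ∷ [])
          square false false = solve (p ∷ q ∷ [])

        A⊛splitWeights : (A G ⊛ splitWeights G T v p q) v ≡ p * a
        A⊛splitWeights =
          trans (sum-cong-≗ (λ w → restrict (adj G v w) (χ T w))) (sym (*-distribˡ-sum p (λ w → A G v w * χ T w)))
          where
          restrict : ∀ e s → ⟦ e ⟧ * (s * (p * ⟦ e ⟧ + q * (1 - ⟦ e ⟧))) ≡ p * (⟦ e ⟧ * s)
          restrict true  s = solve (s ∷ p ∷ q ∷ [])
          restrict false s = solve (s ∷ p ∷ q ∷ [])

    K-sym : ∀ α β → IsSymmetric (K G α β)
    K-sym α β i j = cong₂ (λ x d → α * x + β * d - 1) (A-sym i j) (δ-sym i j)

    K⊛ : ∀ α β f i → (K G α β ⊛ f) i ≡ α * (A G ⊛ f) i + β * f i - sum f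
    K⊛ α β f i =
      trans (⊛-affine {N = K G α β} (A G) α β (- 1) (λ _ _ → refl) f i) (cong (α * (A G ⊛ f) i + β * f i +_) (ℤ.-1*i≡-i (sum f)))

    quadForm-K : ∀ α β y → quadForm (K G α β) y ≡ α * quadForm (A G) y + β * ⟪ y , y ⟫ - sum y * sum y
    quadForm-K α β y = begin
      ∑[ w < n ] (y w * (K G α β ⊛ y) w)
        ≡⟨ sum-cong-≗ (λ w → trans (cong (y w *_) (K⊛ α β y w)) (distrib (y w) ((A G ⊛ y) w) (sum y))) ⟩
      ∑[ w < n ] (α * (y w * (A G ⊛ y) w) + β * (y w * y w) + (- sum y) * y w)
        ≡⟨ ∑-linear₃ α β (- sum y) (λ w → y w * (A G ⊛ y) w) (λ w → y w * y w) y ⟩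
      α * quadForm (A G) y + β * ⟪ y , y ⟫ + (- sum y) * sum y
        ≡⟨ collect (quadForm (A G) y) ⟪ y , y ⟫ (sum y) ⟩
      α * quadForm (A G) y + β * ⟪ y , y ⟫ - sum y * sum y ∎
      where
      open ≡-Reasoning
      distrib : ∀ x r s → x * (α * r + β * x - s) ≡ α * (x * r) + β * (x * x) + (- s) * x
      distrib x r s = solve (x ∷ r ∷ s ∷ α ∷ β ∷ [])
      collect : ∀ q r s → α * q + β * r + (- s) * s ≡ α * q + β * r - s * s
      collect q r s = solve (q ∷ r ∷ s ∷ α ∷ β ∷ [])

    quadForm-K-split : ∀ {T v} → IsClique G T → v ∉ T → ∀ α β p q t →
      let a = (A G ⊛ χ T) v
          b = ∣ T ∣ᶻ - a
          X = p * a + q * b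
          Y = p * p * a + q * q * b
      in quadForm (K G α β) (λ w → splitWeights G T v p q w + t * δ v w)
           ≡ α * (X * X - Y) + β * Y - X * X + 2 * t * (α * (p * a) - X) + t * t * (β - 1)
    quadForm-K-split {T} {v} T-clique v∉T α β p q t = begin
      quadForm (K G α β) (λ w → y w + t * δ v w)
        ≡⟨ quadForm-+-basis (K-sym α β) y t v ⟩
      quadForm (K G α β) y + 2 * t * (K G α β ⊛ y) v + t * t * K G α β v v
        ≡⟨ cong₂ (λ Q r → Q + 2 * t * r + t * t * K G α β v v) Qy (K⊛ α β y v) ⟩
      α * (X * X - Y) + β * Y - X * X + 2 * t * (α * (A G ⊛ y) v + β * y v - sum y) + t * t * K G α β v v
        ≡⟨ cong₂ (λ r s → α * (X * X - Y) + β * Y - X * X + 2 * t * (α * r + β * y v - s) + t * t * K G α β v v)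
                 (A⊛splitWeights T v p q) (∑-splitWeights T v p q) ⟩
      α * (X * X - Y) + β * Y - X * X + 2 * t * (α * (p * a) + β * y v - X) + t * t * K G α β v v
        ≡⟨ cong₂ (λ r d → α * (X * X - Y) + β * Y - X * X + 2 * t * (α * (p * a) + β * r - X) + t * t * d)
                 (splitWeights-supported T v p q v v∉T) Kvv ⟩
      α * (X * X - Y) + β * Y - X * X + 2 * t * (α * (p * a) + β * 0 - X) + t * t * (α * 0 + β * 1 - 1)
        ≡⟨ simplify (α * (X * X - Y) + β * Y - X * X) α β (p * a) X t ⟩
      α * (X * X - Y) + β * Y - X * X + 2 * t * (α * (p * a) - X) + t * t * (β - 1) ∎
      where
      open ≡-Reasoning
      y : Vector ℤ n
      y = splitWeights G T v p q
      a X Y : ℤ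
      a = (A G ⊛ χ T) v
      X = p * a + q * (∣ T ∣ᶻ - a)
      Y = p * p * a + q * q * (∣ T ∣ᶻ - a)
      Qy : quadForm (K G α β) y ≡ α * (X * X - Y) + β * Y - X * X
      Qy = begin
        quadForm (K G α β) y
          ≡⟨ quadForm-K α β y ⟩
        α * quadForm (A G) y + β * ⟪ y , y ⟫ - sum y * sum y
          ≡⟨ cong (λ Q → α * Q + β * ⟪ y , y ⟫ - sum y * sum y) (quadForm-clique T-clique (splitWeights-supported T v p q)) ⟩
        α * (sum y * sum y - ⟪ y , y ⟫) + β * ⟪ y , y ⟫ - sum y * sum y
          ≡⟨ cong₂ (λ S N → α * (S * S - N) + β * N - S * S) (∑-splitWeights T v p q) (⟪⟫-splitWeights T v p q) ⟩
        α * (X * X - Y) + β * Y - X * X ∎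
      Kvv : K G α β v v ≡ α * 0 + β * 1 - 1
      Kvv = cong₂ (λ x d → α * x + β * d - 1) (A-diag v) (δ-refl v)
      simplify : ∀ Q α β r X t → Q + 2 * t * (α * r + β * 0 - X) + t * t * (α * 0 + β * 1 - 1) ≡ Q + 2 * t * (α * r - X) + t * t * (β - 1)
      simplify = solve-∀

  IsMaximalClique : Graph n → Subset n → Set
  IsMaximalClique G T = IsClique G T × (∀ v → v ∉ T → ∃[ y ] (y ∈ T × adj G v y ≡ false))

  module _ {n : ℕ} (G : Graph n) where

    clique-∪-⁅⁆ : ∀ {S v} → IsClique G S → (∀ y → y ∈ S → adj G v y ≡ true) → IsClique G (S ∪ ⁅ v ⁆)
    clique-∪-⁅⁆ {S} {v} S-clique v~S x y x∈ y∈ x≢y with x∈p∪q⁻ S ⁅ v ⁆ x∈ | x∈p∪q⁻ S ⁅ v ⁆ y∈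
    ... | inj₁ x∈S | inj₁ y∈S = S-clique x y x∈S y∈S x≢y
    ... | inj₁ x∈S | inj₂ y∈v rewrite x∈⁅y⁆⇒x≡y v y∈v = trans (symm G x v) (v~S x x∈S)
    ... | inj₂ x∈v | inj₁ y∈S rewrite x∈⁅y⁆⇒x≡y v x∈v = v~S y y∈S
    ... | inj₂ x∈v | inj₂ y∈v = ⊥-elim (x≢y (trans (x∈⁅y⁆⇒x≡y v x∈v) (sym (x∈⁅y⁆⇒x≡y v y∈v))))

    extend-to-maximal : ∀ S → IsClique G S → ∃[ T ] (S ⊆ T × IsMaximalClique G T)
    extend-to-maximal S = go S (⊃-wellFounded S)
      where
      go : ∀ S → Acc _⊃_ S → IsClique G S → ∃[ T ] (S ⊆ T × IsMaximalClique G T)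
      go S (acc larger) S-clique
        with any? (λ v → ¬? (v ∈? S) ×-dec all? (λ y → y ∈? S →-dec adj G v y Bool.≟ true))
      ... | yes (v , v∉S , v~S) =
        let T , S∪v⊆T , T-maximal = go (S ∪ ⁅ v ⁆) (larger S⊂S∪v) (clique-∪-⁅⁆ S-clique v~S)
        in T , ⊆-trans (p⊆p∪q ⁅ v ⁆) S∪v⊆T , T-maximal
        where
        S⊂S∪v : (S ∪ ⁅ v ⁆) ⊃ S
        S⊂S∪v = p⊆p∪q ⁅ v ⁆ , v , x∈p∪q⁺ (inj₂ (x∈⁅x⁆ v)) , v∉S
      ... | no ¬extensible = S , ⊆-refl , S-clique , non-neighbour
        where
        non-neighbour : ∀ v → v ∉ S → ∃[ y ] (y ∈ S × adj G v y ≡ false)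
        non-neighbour v v∉S
          with y , ¬y→v~y ← ¬∀⟶∃¬ n _ (λ y → y ∈? S →-dec adj G v y Bool.≟ true) (λ v~S → ¬extensible (v , v∉S , v~S))
          with y ∈? S
        ... | yes y∈S = y , y∈S , ¬-not (λ v~y → ¬y→v~y (λ _ → v~y))
        ... | no y∉S  = ⊥-elim (¬y→v~y (λ y∈S → ⊥-elim (y∉S y∈S)))

  module StronglyRegular {n : ℕ} {G : Graph n} {k lam mu : ℕ} (srg : IsSRG G k lam mu) where

    open Adjacency G public

    A⊛𝟏 : ∀ i → (A G ⊛ (λ _ → 1)) i ≡ ℤ.+ k
    A⊛𝟏 i = begin
      ∑[ j < n ] (A G i j * 1)  ≡⟨ sum-cong-≗ (λ j → ℤ.*-identityʳ (A G i j)) ⟩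
      ∑[ j < n ] A G i j        ≡⟨ ∑-length-filterᵇ (adj G i) id ⟨
      ℤ.+ degree G i            ≡⟨ cong ℤ.+_ (proj₁ srg i) ⟩
      ℤ.+ k                     ∎
      where open ≡-Reasoning

    ∑-A⊛ : (f : Vector ℤ n) → sum (A G ⊛ f) ≡ ℤ.+ k * sum f
    ∑-A⊛ f = begin
      sum (A G ⊛ f)             ≡⟨ sum-cong-≗ (λ i → ℤ.*-identityˡ ((A G ⊛ f) i)) ⟨
      ⟪ (λ _ → 1) , A G ⊛ f ⟫   ≡⟨ ⊛-self-adjoint A-sym (λ _ → 1) f ⟩
      ⟪ A G ⊛ (λ _ → 1) , f ⟫   ≡⟨ sum-cong-≗ (λ i → cong (_* f i) (A⊛𝟏 i)) ⟩
      ∑[ i < n ] (ℤ.+ k * f i)  ≡⟨ *-distribˡ-sum (ℤ.+ k) f ⟨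
      ℤ.+ k * sum f             ∎
      where open ≡-Reasoning

    A·A≡commonNbrs : ∀ i j → (A G · A G) i j ≡ ℤ.+ commonNbrs G i j
    A·A≡commonNbrs i j =
      trans (sum-cong-≗ (λ u → trans (cong (A G i u *_) (A-sym u j)) (sym (⟦∧⟧ (adj G i u) (adj G j u)))))
            (sym (∑-length-filterᵇ (λ u → adj G i u ∧ adj G j u) id))

    A·A-diag : ∀ i → (A G · A G) i i ≡ ℤ.+ k
    A·A-diag i = trans (sum-cong-≗ (λ u → trans (cong (A G i u *_) (A-sym u i)) idem)) (A⊛𝟏 i)
      where
      idem : ∀ {u} → A G i u * A G i u ≡ A G i u * 1
      idem {u} = trans (⟦⟧-idem (adj G i u)) (sym (ℤ.*-identityʳ (A G i u)))

    A·A : ∀ i j → (A G · A G) i j ≡ (ℤ.+ lam - ℤ.+ mu) * A G i j + (ℤ.+ k - ℤ.+ mu) * δ i j + ℤ.+ mu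
    A·A i j with i ≟ j
    ... | yes refl rewrite A·A-diag i | A-diag i = diagonal (ℤ.+ lam) (ℤ.+ k) (ℤ.+ mu)
      where
      diagonal : ∀ l k m → k ≡ (l - m) * 0 + (k - m) * 1 + m
      diagonal = solve-∀
    ... | no i≢j with adj G i j in i~j
    ...   | true  =
      trans (A·A≡commonNbrs i j) (trans (cong ℤ.+_ (proj₁ (proj₂ srg) i j i≢j i~j)) (adjacent (ℤ.+ lam) (ℤ.+ k) (ℤ.+ mu)))
      where
      adjacent : ∀ l k m → l ≡ (l - m) * 1 + (k - m) * 0 + m
      adjacent = solve-∀
    ...   | false =
      trans (A·A≡commonNbrs i j) (trans (cong ℤ.+_ (proj₂ (proj₂ srg) i j i≢j i~j)) (nonadjacent (ℤ.+ lam) (ℤ.+ k) (ℤ.+ mu)))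
      where
      nonadjacent : ∀ l k m → m ≡ (l - m) * 0 + (k - m) * 0 + m
      nonadjacent = solve-∀

    ∑-K-column : ∀ α β j → ∑[ u < n ] K G α β u j ≡ α * ℤ.+ k + β - ℤ.+ n
    ∑-K-column α β j = begin
      ∑[ u < n ] K G α β u j
        ≡⟨ sum-cong-≗ (λ u → trans (K-sym α β u j) (sym (ℤ.*-identityʳ (K G α β j u)))) ⟩
      (K G α β ⊛ (λ _ → 1)) j
        ≡⟨ K⊛ α β (λ _ → 1) j ⟩
      α * (A G ⊛ (λ _ → 1)) j + β * 1 - ∑[ u < n ] 1
        ≡⟨ cong₂ (λ d s → α * d + β * 1 - s) (A⊛𝟏 j) (trans (∑-const n 1) (ℤ.*-identityʳ (ℤ.+ n))) ⟩
      α * ℤ.+ k + β * 1 - ℤ.+ n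
        ≡⟨ cong (λ x → α * ℤ.+ k + x - ℤ.+ n) (ℤ.*-identityʳ β) ⟩
      α * ℤ.+ k + β - ℤ.+ n ∎
      where open ≡-Reasoning

    A·K : ∀ α β i j → (A G · K G α β) i j ≡ α * (A G · A G) i j + β * A G i j - ℤ.+ k
    A·K α β i j = begin
      ∑[ u < n ] (A G i u * K G α β u j)
        ≡⟨ sum-cong-≗ (λ u → trans (ℤ.*-comm (A G i u) (K G α β u j)) (cong (_* A G i u) (K-sym α β u j))) ⟩
      (K G α β ⊛ A G i) j
        ≡⟨ K⊛ α β (A G i) j ⟩
      α * (A G ⊛ A G i) j + β * A G i j - sum (A G i)
        ≡⟨ cong₂ (λ x s → α * x + β * A G i j - s) A⊛row row-sum ⟩
      α * (A G · A G) i j + β * A G i j - ℤ.+ k ∎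
      where
      open ≡-Reasoning
      A⊛row : (A G ⊛ A G i) j ≡ (A G · A G) i j
      A⊛row = sum-cong-≗ (λ u → trans (ℤ.*-comm (A G j u) (A G i u)) (cong (A G i u *_) (A-sym j u)))
      row-sum : sum (A G i) ≡ ℤ.+ k
      row-sum = trans (sum-cong-≗ (λ u → sym (ℤ.*-identityʳ (A G i u)))) (A⊛𝟏 i)

    K·K : ∀ α β i j →
      (K G α β · K G α β) i j ≡ α * (A G · K G α β) i j + β * K G α β i j - (α * ℤ.+ k + β - ℤ.+ n)
    K·K α β i j =
      trans (K⊛ α β (λ u → K G α β u j) i)
            (cong (λ s → α * (A G · K G α β) i j + β * K G α β i j - s) (∑-K-column α β j))

    module _ {T : Subset n} (T-clique : IsClique G T) where

      ⟪χ,χ⟫ : ⟪ χ T , χ T ⟫ ≡ ∣ T ∣ᶻ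
      ⟪χ,χ⟫ = sum-cong-≗ (λ w → ⟦⟧-idem (lookup T w))

      ‖A⊛χ‖² : ⟪ A G ⊛ χ T , A G ⊛ χ T ⟫ ≡ ∣ T ∣ᶻ * (ℤ.+ k + (∣ T ∣ᶻ - 1) * ℤ.+ lam)
      ‖A⊛χ‖² = begin
        ⟪ A G ⊛ χ T , A G ⊛ χ T ⟫
          ≡⟨ ⊛-self-adjoint A-sym (χ T) (A G ⊛ χ T) ⟨
        ∑[ w < n ] (χ T w * (A G ⊛ A G ⊛ χ T) w)
          ≡⟨ sum-cong-≗ (λ w → cong (χ T w *_) (trans (sym (⊛-assoc (A G) (A G) (χ T) w)) (A²⊛χ w))) ⟩
        ∑[ w < n ] (χ T w * ((ℤ.+ lam - ℤ.+ mu) * (A G ⊛ χ T) w + (ℤ.+ k - ℤ.+ mu) * χ T w + ℤ.+ mu * ∣ T ∣ᶻ))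
          ≡⟨ sum-cong-≗ (λ w → distrib (χ T w) (ℤ.+ lam - ℤ.+ mu) ((A G ⊛ χ T) w) (ℤ.+ k - ℤ.+ mu) (ℤ.+ mu * ∣ T ∣ᶻ)) ⟩
        ∑[ w < n ] ((ℤ.+ lam - ℤ.+ mu) * (χ T w * (A G ⊛ χ T) w) + (ℤ.+ k - ℤ.+ mu) * (χ T w * χ T w) + ℤ.+ mu * ∣ T ∣ᶻ * χ T w)
          ≡⟨ ∑-linear₃ (ℤ.+ lam - ℤ.+ mu) (ℤ.+ k - ℤ.+ mu) (ℤ.+ mu * ∣ T ∣ᶻ) (λ w → χ T w * (A G ⊛ χ T) w) (λ w → χ T w * χ T w) (χ T) ⟩
        (ℤ.+ lam - ℤ.+ mu) * quadForm (A G) (χ T) + (ℤ.+ k - ℤ.+ mu) * ⟪ χ T , χ T ⟫ + ℤ.+ mu * ∣ T ∣ᶻ * ∣ T ∣ᶻ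
          ≡⟨ cong₂ (λ q s → (ℤ.+ lam - ℤ.+ mu) * q + (ℤ.+ k - ℤ.+ mu) * s + ℤ.+ mu * ∣ T ∣ᶻ * ∣ T ∣ᶻ)
                   (trans (quadForm-clique T-clique (λ _ → χ-∉)) (cong (λ s → ∣ T ∣ᶻ * ∣ T ∣ᶻ - s) ⟪χ,χ⟫)) ⟪χ,χ⟫ ⟩
        (ℤ.+ lam - ℤ.+ mu) * (∣ T ∣ᶻ * ∣ T ∣ᶻ - ∣ T ∣ᶻ) + (ℤ.+ k - ℤ.+ mu) * ∣ T ∣ᶻ + ℤ.+ mu * ∣ T ∣ᶻ * ∣ T ∣ᶻ
          ≡⟨ collect (ℤ.+ lam) (ℤ.+ k) (ℤ.+ mu) ∣ T ∣ᶻ ⟩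
        ∣ T ∣ᶻ * (ℤ.+ k + (∣ T ∣ᶻ - 1) * ℤ.+ lam) ∎
        where
        open ≡-Reasoning
        A²⊛χ : ∀ w → ((A G · A G) ⊛ χ T) w ≡ (ℤ.+ lam - ℤ.+ mu) * (A G ⊛ χ T) w + (ℤ.+ k - ℤ.+ mu) * χ T w + ℤ.+ mu * ∣ T ∣ᶻ
        A²⊛χ = ⊛-affine (A G) (ℤ.+ lam - ℤ.+ mu) (ℤ.+ k - ℤ.+ mu) (ℤ.+ mu) A·A (χ T)
        distrib : ∀ x a r b s → x * (a * r + b * x + s) ≡ a * (x * r) + b * (x * x) + s * x
        distrib = solve-∀
        collect : ∀ l k m x → (l - m) * (x * x - x) + (k - m) * x + m * x * x ≡ x * (k + (x - 1) * l)
        collect = solve-∀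

      A⊛χ-outside≤mu : ∀ {v y} → v ∉ T → y ∈ T → adj G v y ≡ false → (A G ⊛ χ T) v ≤ ℤ.+ mu
      A⊛χ-outside≤mu {v} {y} v∉T y∈T v≁y = begin
        ∑[ w < n ] (A G v w * χ T w)  ≤⟨ ∑-mono-≤ entry ⟩
        (A G · A G) v y               ≡⟨ A·A≡commonNbrs v y ⟩
        ℤ.+ commonNbrs G v y          ≡⟨ cong ℤ.+_ (proj₂ (proj₂ srg) v y v≢y v≁y) ⟩
        ℤ.+ mu                        ∎
        where
        open ℤ.≤-Reasoning
        v≢y : v ≢ y
        v≢y refl = v∉T y∈T
        ≢y : ∀ {w} → adj G v w ≡ true → w ≢ y
        ≢y v~w refl with () ← trans (sym v~w) v≁y
        entry : ∀ w → A G v w * χ T w ≤ A G v w * A G w y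
        entry w with adj G v w in v~w | lookup T w in w∈T
        ... | false | _     = ℤ.≤-refl
        ... | true  | false = ℤ.≤-trans (⟦⟧-nonneg (adj G w y)) (ℤ.≤-reflexive (sym (ℤ.*-identityˡ (A G w y))))
        ... | true  | true  rewrite A-edge (T-clique w y (lookup⇒[]= w T w∈T) y∈T (≢y v~w)) = ℤ.≤-refl

      module _ {m : ℤ} (outside≤m : ∀ v → v ∉ T → (A G ⊛ χ T) v ≤ m) where

        private
          a : Vector ℤ n
          a = A G ⊛ χ T

        member-or-outsider : ∀ v → (χ T v ≡ 1 × a v ≡ ∣ T ∣ᶻ - 1) ⊎ (χ T v ≡ 0 × a v ≤ m)
        member-or-outsider v with v ∈? T
        ... | yes v∈T = inj₁ (χ-∈ v∈T , A⊛χ-member T-clique v∈T)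
        ... | no  v∉T = inj₂ (χ-∉ v∉T , outside≤m v v∉T)

        first-moment-bound : ℤ.+ k * ∣ T ∣ᶻ ≤ ℤ.+ n * m + ∣ T ∣ᶻ * (∣ T ∣ᶻ - (m + 1))
        first-moment-bound = begin
          ℤ.+ k * ∣ T ∣ᶻ
            ≡⟨ ∑-A⊛ (χ T) ⟨
          sum a
            ≤⟨ ∑-mono-≤ pointwise ⟩
          ∑[ v < n ] (m + χ T v * (∣ T ∣ᶻ - (m + 1)))
            ≡⟨ ∑-distrib-+ (λ _ → m) (λ v → χ T v * (∣ T ∣ᶻ - (m + 1))) ⟩
          ∑[ v < n ] m + ∑[ v < n ] (χ T v * (∣ T ∣ᶻ - (m + 1)))
            ≡⟨ cong₂ _+_ (∑-const n m) (sym (*-distribʳ-sum (∣ T ∣ᶻ - (m + 1)) (χ T))) ⟩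
          ℤ.+ n * m + ∣ T ∣ᶻ * (∣ T ∣ᶻ - (m + 1)) ∎
          where
          open ℤ.≤-Reasoning
          member : ∀ x m → x - 1 ≡ m + 1 * (x - (m + 1))
          member = solve-∀
          pointwise : ∀ v → a v ≤ m + χ T v * (∣ T ∣ᶻ - (m + 1))
          pointwise v with member-or-outsider v
          ... | inj₁ (χv≡1 , av≡) rewrite χv≡1 | av≡ = ℤ.≤-reflexive (member ∣ T ∣ᶻ m)
          ... | inj₂ (χv≡0 , av≤m) rewrite χv≡0 = ℤ.≤-trans av≤m (ℤ.≤-reflexive (sym (ℤ.+-identityʳ m)))

        second-moment-bound : ∣ T ∣ᶻ * ((∣ T ∣ᶻ - 1) * (m + 1 - ∣ T ∣ᶻ)) ≤ m * (ℤ.+ k * ∣ T ∣ᶻ) - ∣ T ∣ᶻ * (ℤ.+ k + (∣ T ∣ᶻ - 1) * ℤ.+ lam)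
        second-moment-bound = begin
          ∣ T ∣ᶻ * ((∣ T ∣ᶻ - 1) * (m + 1 - ∣ T ∣ᶻ))
            ≡⟨ *-distribʳ-sum ((∣ T ∣ᶻ - 1) * (m + 1 - ∣ T ∣ᶻ)) (χ T) ⟩
          ∑[ v < n ] (χ T v * ((∣ T ∣ᶻ - 1) * (m + 1 - ∣ T ∣ᶻ)))
            ≤⟨ ∑-mono-≤ pointwise ⟩
          ∑[ v < n ] (m * a v - a v * a v)
            ≡⟨ ∑-distrib-- (λ v → m * a v) (λ v → a v * a v) ⟩
          ∑[ v < n ] (m * a v) - ⟪ a , a ⟫
            ≡⟨ cong₂ _-_ (trans (sym (*-distribˡ-sum m a)) (cong (m *_) (∑-A⊛ (χ T)))) ‖A⊛χ‖² ⟩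
          m * (ℤ.+ k * ∣ T ∣ᶻ) - ∣ T ∣ᶻ * (ℤ.+ k + (∣ T ∣ᶻ - 1) * ℤ.+ lam) ∎
          where
          open ℤ.≤-Reasoning
          member : ∀ x m → 1 * ((x - 1) * (m + 1 - x)) ≡ m * (x - 1) - (x - 1) * (x - 1)
          member = solve-∀
          outsider : ∀ x → x * (m - x) ≡ m * x - x * x
          outsider x = solve (x ∷ m ∷ [])
          pointwise : ∀ v → χ T v * ((∣ T ∣ᶻ - 1) * (m + 1 - ∣ T ∣ᶻ)) ≤ m * a v - a v * a v
          pointwise v with member-or-outsider v
          ... | inj₁ (χv≡1 , av≡) rewrite χv≡1 | av≡ = ℤ.≤-reflexive (member ∣ T ∣ᶻ m)
          ... | inj₂ (χv≡0 , av≤m) rewrite χv≡0 =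
            ℤ.≤-trans (*-nonneg (A⊛χ-nonneg T v) (ℤ.i≤j⇒0≤j-i av≤m)) (ℤ.≤-reflexive (outsider (a v)))

      third-moment-bound : ∣ T ∣ᶻ * ((∣ T ∣ᶻ - 1) * (∣ T ∣ᶻ - 1)) ≤ ∣ T ∣ᶻ * (ℤ.+ k + (∣ T ∣ᶻ - 1) * ℤ.+ lam)
      third-moment-bound = begin
        ∣ T ∣ᶻ * ((∣ T ∣ᶻ - 1) * (∣ T ∣ᶻ - 1))
          ≡⟨ *-distribʳ-sum ((∣ T ∣ᶻ - 1) * (∣ T ∣ᶻ - 1)) (χ T) ⟩
        ∑[ v < n ] (χ T v * ((∣ T ∣ᶻ - 1) * (∣ T ∣ᶻ - 1)))
          ≤⟨ ∑-mono-≤ pointwise ⟩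
        ⟪ A G ⊛ χ T , A G ⊛ χ T ⟫
          ≡⟨ ‖A⊛χ‖² ⟩
        ∣ T ∣ᶻ * (ℤ.+ k + (∣ T ∣ᶻ - 1) * ℤ.+ lam) ∎
        where
        open ℤ.≤-Reasoning
        pointwise : ∀ v → χ T v * ((∣ T ∣ᶻ - 1) * (∣ T ∣ᶻ - 1)) ≤ (A G ⊛ χ T) v * (A G ⊛ χ T) v
        pointwise v with v ∈? T
        ... | yes v∈T rewrite χ-∈ v∈T | A⊛χ-member T-clique v∈T = ℤ.≤-reflexive (ℤ.*-identityˡ _)
        ... | no  v∉T rewrite χ-∉ v∉T = square-nonneg ((A G ⊛ χ T) v)

  outsider-arithmetic : ∀ {a c} → a ≤ 27 → 33 ≤ c → (c - a) * (3 * a - 17) ≤ 4 * (3 * a + 10) → a ≤ 7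
  outsider-arithmetic {a} {c} a≤27 33≤c R = [ id , (λ 8≤a → ⊥-elim (impossible 8≤a)) ]′ (≤⊎1+≤ 7 a)
    where
    impossible : 8 ≤ a → ⊥
    impossible 8≤a = nonneg≢negative nonneg (certificate a c)
      where
      0≤a-8 : 0 ≤ a - 8
      0≤a-8 = ℤ.i≤j⇒0≤j-i 8≤a
      0≤27-a : 0 ≤ 27 - a
      0≤27-a = ℤ.i≤j⇒0≤j-i a≤27
      0≤c-33 : 0 ≤ c - 33
      0≤c-33 = ℤ.i≤j⇒0≤j-i 33≤c
      nonneg : 0 ≤ 4 * (3 * a + 10) - (c - a) * (3 * a - 17)
                 + 3 * ((a - 8) * (27 - a)) + 3 * ((c - 33) * (a - 8)) + 7 * (c - 33) + (27 - a)
      nonneg =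
        ℤ.+-mono-≤ (ℤ.+-mono-≤ (ℤ.+-mono-≤ (ℤ.+-mono-≤ (ℤ.i≤j⇒0≤j-i R)
          (*-nonneg (ℤ.nonNegative⁻¹ 3) (*-nonneg 0≤a-8 0≤27-a)))
          (*-nonneg (ℤ.nonNegative⁻¹ 3) (*-nonneg 0≤c-33 0≤a-8)))
          (*-nonneg (ℤ.nonNegative⁻¹ 7) 0≤c-33))
          0≤27-a
      certificate : ∀ a c → 4 * (3 * a + 10) - (c - a) * (3 * a - 17)
        + 3 * ((a - 8) * (27 - a)) + 3 * ((c - 33) * (a - 8)) + 7 * (c - 33) + (27 - a) ≡ - 20
      certificate = solve-∀

  clique-size-33…61 : ∀ {c} → 33 ≤ c → c ≤ 61 →
    ¬ (c * ((c - 1) * (8 - c)) ≤ 7 * (270 * c) - c * (270 + (c - 1) * 105))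
  clique-size-33…61 {c} 33≤c c≤61 I = nonneg≢negative nonneg (certificate c)
    where
    0≤c-33 : 0 ≤ c - 33
    0≤c-33 = ℤ.i≤j⇒0≤j-i 33≤c
    nonneg : 0 ≤ 7 * (270 * c) - c * (270 + (c - 1) * 105) - c * ((c - 1) * (8 - c))
               + c * ((c - 33) * (61 - c)) + 20 * ((c - 33) * (c - 33)) + 1600 * (c - 33)
    nonneg =
      ℤ.+-mono-≤ (ℤ.+-mono-≤ (ℤ.+-mono-≤ (ℤ.i≤j⇒0≤j-i I)
        (*-nonneg (ℤ.≤-trans (ℤ.nonNegative⁻¹ 33) 33≤c) (*-nonneg 0≤c-33 (ℤ.i≤j⇒0≤j-i c≤61))))
        (*-nonneg (ℤ.nonNegative⁻¹ 20) (*-nonneg 0≤c-33 0≤c-33)))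
        (*-nonneg (ℤ.nonNegative⁻¹ 1600) 0≤c-33)
    certificate : ∀ c → 7 * (270 * c) - c * (270 + (c - 1) * 105) - c * ((c - 1) * (8 - c))
      + c * ((c - 33) * (61 - c)) + 20 * ((c - 33) * (c - 33)) + 1600 * (c - 33) ≡ - 31020
    certificate = solve-∀

  clique-size-62…108 : ∀ {c} → 62 ≤ c → c ≤ 108 → ¬ (270 * c ≤ 1911 * 7 + c * (c - 8))
  clique-size-62…108 {c} 62≤c c≤108 II = nonneg≢negative nonneg (certificate c)
    where
    0≤c-62 : 0 ≤ c - 62
    0≤c-62 = ℤ.i≤j⇒0≤j-i 62≤c
    nonneg : 0 ≤ 1911 * 7 + c * (c - 8) - 270 * c + (c - 62) * (108 - c) + 108 * (c - 62)
    nonneg =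
      ℤ.+-mono-≤ (ℤ.+-mono-≤ (ℤ.i≤j⇒0≤j-i II)
        (*-nonneg 0≤c-62 (ℤ.i≤j⇒0≤j-i c≤108)))
        (*-nonneg (ℤ.nonNegative⁻¹ 108) 0≤c-62)
    certificate : ∀ c → 1911 * 7 + c * (c - 8) - 270 * c + (c - 62) * (108 - c) + 108 * (c - 62) ≡ - 15
    certificate = solve-∀

  clique-size-≥109 : ∀ {c} → 109 ≤ c → ¬ (c * ((c - 1) * (c - 1)) ≤ c * (270 + (c - 1) * 105))
  clique-size-≥109 {c} 109≤c III = nonneg≢negative nonneg (certificate c)
    where
    0≤c : 0 ≤ c
    0≤c = ℤ.≤-trans (ℤ.nonNegative⁻¹ 109) 109≤c
    0≤c-109 : 0 ≤ c - 109
    0≤c-109 = ℤ.i≤j⇒0≤j-i 109≤c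
    nonneg : 0 ≤ c * (270 + (c - 1) * 105) - c * ((c - 1) * (c - 1))
               + c * (c * (c - 109)) + 2 * (c * (c - 109)) + 54 * (c - 109)
    nonneg =
      ℤ.+-mono-≤ (ℤ.+-mono-≤ (ℤ.+-mono-≤ (ℤ.i≤j⇒0≤j-i III)
        (*-nonneg 0≤c (*-nonneg 0≤c 0≤c-109)))
        (*-nonneg (ℤ.nonNegative⁻¹ 2) (*-nonneg 0≤c 0≤c-109)))
        (*-nonneg (ℤ.nonNegative⁻¹ 54) 0≤c-109)
    certificate : ∀ c → c * (270 + (c - 1) * 105) - c * ((c - 1) * (c - 1))
      + c * (c * (c - 109)) + 2 * (c * (c - 109)) + 54 * (c - 109) ≡ - 5886
    certificate = solve-∀

  clique-size-arithmetic : ∀ {c} → 33 ≤ c →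
    c * ((c - 1) * (8 - c)) ≤ 7 * (270 * c) - c * (270 + (c - 1) * 105) →
    270 * c ≤ 1911 * 7 + c * (c - 8) →
    c * ((c - 1) * (c - 1)) ≤ c * (270 + (c - 1) * 105) → ⊥
  clique-size-arithmetic {c} 33≤c I II III =
    [ (λ c≤61 → clique-size-33…61 33≤c c≤61 I)
    , (λ 62≤c → [ (λ c≤108 → clique-size-62…108 62≤c c≤108 II) , (λ 109≤c → clique-size-≥109 109≤c III) ]′ (≤⊎1+≤ 108 c))
    ]′ (≤⊎1+≤ 61 c)

  module _ {G : Graph 1911} (srg : IsSRG G 270 105 27) where

    open StronglyRegular {G = G} {k = 270} {lam = 105} {mu = 27} srg

    -- Naming the coefficients of K keeps overloaded literals, whose instances are resolved late,
    -- out of the 1911-term sums that Agda has to compare.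
    private
      α β : ℤ
      α = 7
      β = 21

    A·K-expanded : ∀ i j → (A G · K G α β) i j
      ≡ α * ((ℤ.+ 105 - ℤ.+ 27) * A G i j + (ℤ.+ 270 - ℤ.+ 27) * δ i j + ℤ.+ 27) + β * A G i j - ℤ.+ 270
    A·K-expanded i j = trans (A·K α β i j) (cong (λ x → α * x + β * A G i j - ℤ.+ 270) (A·A i j))

    K·K≡588K : ∀ i j → (K G α β · K G α β) i j ≡ 588 * K G α β i j
    K·K≡588K i j =
      trans (K·K α β i j)
        (trans (cong (λ x → α * x + β * K G α β i j - (α * ℤ.+ 270 + β - ℤ.+ 1911)) (A·K-expanded i j))
               (collect (A G i j) (δ i j)))
      where
      collect : ∀ a d → 7 * (7 * ((105 - 27) * a + (270 - 27) * d + 27) + 21 * a - 270) + 21 * (7 * a + 21 * d - 1)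
                          - (7 * 270 + 21 - 1911) ≡ 588 * (7 * a + 21 * d - 1)
      collect = solve-∀

    K-psd : ∀ z → 0 ≤ quadForm (K G α β) z
    K-psd = quadForm-nonneg {M = K G α β} {k = 588} (K-sym α β) (ℤ.positive⁻¹ 588) K·K≡588K

    module _ {T : Subset 1911} (T-clique : IsClique G T) {v : Fin 1911} (v∉T : v ∉ T) where

      private
        a b : ℤ
        a = (A G ⊛ χ T) v
        b = ∣ T ∣ᶻ - a

      outsider-inequality : 0 < b → b * (3 * a - 17) ≤ 4 * (3 * a + 10)
      outsider-inequality 0<b =
        ℤ.0≤i-j⇒j≤i (*-cancelˡ-nonneg 0<3a+10 (*-cancelˡ-nonneg 0<b (*-cancelˡ-nonneg (ℤ.positive⁻¹ 14) 0≤Q)))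
        where
        -- (p, q, t) is proportional to a column of the adjugate of the Gram matrix of quadForm K on
        -- χ (T ∩ N v), χ (T ∖ N v) and δ v, so the form evaluates to a positive multiple of its determinant.
        p q t : ℤ
        p = 9 * b
        q = - (6 * a + 20)
        t = - (b * (3 * a + 1))
        evaluate : ∀ a b → let p = 9 * b ; q = - (6 * a + 20) ; t = - (b * (3 * a + 1))
                               X = p * a + q * b ; Y = p * p * a + q * q * b in
          7 * (X * X - Y) + 21 * Y - X * X + 2 * t * (7 * (p * a) - X) + t * t * (21 - 1)
            ≡ 14 * (b * ((3 * a + 10) * (4 * (3 * a + 10) - b * (3 * a - 17))))
        evaluate = solve-∀
        0≤Q : 0 ≤ 14 * (b * ((3 * a + 10) * (4 * (3 * a + 10) - b * (3 * a - 17))))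
        0≤Q = subst (0 ≤_) (trans (quadForm-K-split T-clique v∉T α β p q t) (evaluate a b))
                    (K-psd (λ w → splitWeights G T v p q w + t * δ v w))
        0<3a+10 : 0 < 3 * a + 10
        0<3a+10 = ℤ.<-≤-trans (ℤ.positive⁻¹ 10) (ℤ.+-monoˡ-≤ 10 (*-nonneg (ℤ.nonNegative⁻¹ 3) (A⊛χ-nonneg T v)))

    maximal-clique-outside≤7 : ∀ {T} → IsMaximalClique G T → 33 ≤ ∣ T ∣ᶻ → ∀ v → v ∉ T → (A G ⊛ χ T) v ≤ 7
    maximal-clique-outside≤7 (T-clique , T-maximal) 33≤c v v∉T =
      let y , y∈T , v≁y = T-maximal v v∉T
          a≤27 = A⊛χ-outside≤mu T-clique v∉T y∈T v≁y
      in outsider-arithmetic a≤27 33≤c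
           (outsider-inequality T-clique v∉T (ℤ.<-≤-trans (ℤ.positive⁻¹ 6) (ℤ.+-mono-≤ 33≤c (ℤ.neg-mono-≤ a≤27))))

    large-clique-impossible : ∀ {T} → IsClique G T → (∀ v → v ∉ T → (A G ⊛ χ T) v ≤ 7) → ¬ (33 ≤ ∣ T ∣ᶻ)
    large-clique-impossible T-clique outside≤7 33≤c =
      clique-size-arithmetic 33≤c (second-moment-bound T-clique outside≤7)
        (first-moment-bound T-clique outside≤7) (third-moment-bound T-clique)

    maximal-clique-bound : ∀ {T} → IsMaximalClique G T → ∣ T ∣ ℕ.≤ 32
    maximal-clique-bound {T} T-maximal = [ id , too-large ]′ (ℕ.≤-<-connex ∣ T ∣ 32)
      where
      too-large : 32 ℕ.< ∣ T ∣ → ∣ T ∣ ℕ.≤ 32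
      too-large 32<∣T∣ =
        ⊥-elim (large-clique-impossible (proj₁ T-maximal) (maximal-clique-outside≤7 T-maximal 33≤∣T∣) 33≤∣T∣)
        where
        33≤∣T∣ : 33 ≤ ∣ T ∣ᶻ
        33≤∣T∣ = subst (33 ≤_) (∣∣≡∣∣ᶻ T) (+≤+ 32<∣T∣)

open import Data.Fin.Subset.Properties using (p⊆q⇒∣p∣≤∣q∣)
open import Data.Nat.Base using (_≤_)
open import Data.Nat.Properties using (≤-trans)
open import Data.Product using (_,_)

lemma3p4 : (G : Graph 1911) → IsSRG G 270 105 27 →
    (S : Subset 1911) → IsClique G S → ∣ S ∣ ≤ 32
lemma3p4 G srg S S-clique =
  let T , S⊆T , T-maximal = extend-to-maximal G S S-clique
  in ≤-trans (p⊆q⇒∣p∣≤∣q∣ {p = S} {q = T} S⊆T) (maximal-clique-bound {G} srg {T} T-maximal)
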